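{- Let $A=[a_{i,j}]_{i,j\ge1}$ be defined by $a_{1,j}=2$ for $j>1$; $a_{i,j}=a_{i-1,j}+a_{i,j-1}+a_{i-1,j-1}$ for $i>1$, $j>i+1$; $a_{i,i+1}=a_{i-1,i+1}+a_{i-1,i}+2(-1)^{i-1}$ for $i>1$; and $a_{i,j}=-a_{j,i}$ for $j\le i$. Then for all $1\le i<j$, $$a_{i,j}=2\sum_{\ell=1}^{i}(-1)^{\ell-1}s_{i-\ell,\,j-\ell-1},$$ where $s_{p,q}$ are the entries of the Schröder triangle.
   Context: For integers $0\le p\le q$, $s_{p,q}$ is the number of lattice paths from $(0,0)$ to $(p,q)$ using steps $(1,0)$, $(0,1)$, $(1,1)$ that never pass below the line $y=x$ (every visited point $(x,y)$ satisfies $y\ge x$). Equivalently, $s_{0,q}=1$ for $q\ge0$, $s_{p,q}=s_{p-1,q}+s_{p,q-1}+s_{p-1,q-1}$ for $q>p>0$, and $s_{p,p}=s_{p-1,p}+s_{p-1,p-1}$ for $p>0$. -}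

module Defs where

open import Data.Nat using (ℕ; zero; suc; _<ᵇ_; _≡ᵇ_)
import Data.Nat as ℕ
open import Data.Integer using (ℤ; +_; -_; _+_; _*_)
open import Data.Bool using (if_then_else_)

-- Schröder triangle s p q (meaningful for 0 ≤ p ≤ q; value 0 for p > q).
--   s 0 q = 1;  s p q = s (p-1) q + s p (q-1) + s (p-1) (q-1)  for q > p > 0;
--   s p p = s (p-1) p + s (p-1) (p-1)  for p > 0.
s : ℕ → ℕ → ℕ
s zero    q       = 1
s (suc p) zero    = 0
s (suc p) (suc q) =
  if p <ᵇ q then s p (suc q) ℕ.+ s (suc p) q ℕ.+ s p q
  else if p ≡ᵇ q then s p (suc q) ℕ.+ s p q
  else 0

neg1^ : ℕ → ℤ
neg1^ zero    = + 1
neg1^ (suc n) = - neg1^ n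

-- up i j = a_{i,j} for 1 ≤ i < j (1-based indices); junk elsewhere.
--   a_{1,j} = 2 (j > 1)
--   a_{i,i+1} = a_{i-1,i+1} + a_{i-1,i} + 2(-1)^{i-1}      (i > 1)
--   a_{i,j} = a_{i-1,j} + a_{i,j-1} + a_{i-1,j-1}          (i > 1, j > i+1)
-- In the clause below the row is i+2 and the column is j+1.
up : ℕ → ℕ → ℤ
up zero             j       = + 0
up (suc zero)       j       = + 2
up (suc (suc i))    zero    = + 0
up (suc (suc i))    (suc j) =
  if j ≡ᵇ suc (suc i)
  then up (suc i) (suc j) + up (suc i) j + (+ 2) * neg1^ (suc i)
  else up (suc i) (suc j) + up (suc (suc i)) j + up (suc i) j

-- The full matrix A = [a_{i,j}]_{i,j ≥ 1} (1-based; index 0 is junk 0),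
-- with a_{i,j} = - a_{j,i} for j ≤ i (forcing a_{i,i} = 0).
a : ℕ → ℕ → ℤ
a i j = if i <ᵇ j then up i j else (if j <ᵇ i then - up j i else + 0)

sum1 : (ℕ → ℤ) → ℕ → ℤ
sum1 f zero    = + 0
sum1 f (suc n) = sum1 f n + f (suc n)

-- Write b i j for the alternating sum, so that the claim is a i j = 2 b i j, and argue by
-- induction on (i, j) from the first row, where both sides are 2.  For 1 ≤ ℓ ≤ i the ℓ-th summand
-- of b (i+1) (j+1) expands, by the Schröder recurrence at (i+1-ℓ, j-ℓ), into the ℓ-th summands of
-- b i (j+1), b (i+1) j and b i j, while the last summands of b (i+1) (j+1) and b (i+1) j are both
-- (-1)^i.  Hence 2b obeys the recurrence of a for j > i+1.  For j = i+1 the recurrence of s on its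
-- diagonal has no middle term, so only the last summand (-1)^i of b (i+1) j survives, and that is
-- exactly the correction 2(-1)^i in the definition of a on the superdiagonal.
module Submission where

open import Defs
open import Data.Bool using (true; false)
open import Data.Bool.Properties using (T-≡; ¬-not)
open import Data.Integer using (ℤ; +_; _*_; _+_)
open import Data.Integer.Properties using (pos-+; *-identityʳ; *-distribˡ-+; +-commutativeSemigroup)
open import Algebra.Properties.CommutativeSemigroup +-commutativeSemigroup using (interchange)
open import Data.Integer.Tactic.RingSolver using (solve-∀)
open import Data.Nat using (ℕ; zero; suc; _∸_; _≤_; _<_; _<ᵇ_; _≡ᵇ_; s≤s)
import Data.Nat as ℕ
open import Data.Nat.Properties
  using (<⇒<ᵇ; <ᵇ⇒<; ≡⇒≡ᵇ; ≡ᵇ⇒≡; <-irrefl; >⇒≢; n∸n≡0; m≤n⇒m<n∨m≡n; n<1+n; m<n⇒m<1+n)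
open import Data.Sum using ([_,_])
open import Function using (_∘_)
open import Function.Bundles using (Equivalence)
open import Relation.Binary.PropositionalEquality
  using (_≡_; _≢_; refl; sym; trans; cong; cong₂; module ≡-Reasoning)

open Equivalence using (to; from)
open ≡-Reasoning

<⇒<ᵇ≡true : ∀ {m n} → m < n → (m <ᵇ n) ≡ true
<⇒<ᵇ≡true = to T-≡ ∘ <⇒<ᵇ

<ᵇ-irrefl : ∀ n → (n <ᵇ n) ≡ false
<ᵇ-irrefl n = ¬-not (<-irrefl refl ∘ <ᵇ⇒< n n ∘ from T-≡)

≡ᵇ-refl : ∀ n → (n ≡ᵇ n) ≡ true
≡ᵇ-refl n = to T-≡ (≡⇒≡ᵇ n n refl)

≢⇒≡ᵇ≡false : ∀ m n → m ≢ n → (m ≡ᵇ n) ≡ false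
≢⇒≡ᵇ≡false m n m≢n = ¬-not (m≢n ∘ ≡ᵇ⇒≡ m n ∘ from T-≡)

sum1-cong : ∀ {f g : ℕ → ℤ} n → (∀ ℓ → ℓ < n → f (suc ℓ) ≡ g (suc ℓ)) → sum1 f n ≡ sum1 g n
sum1-cong zero    f≗g = refl
sum1-cong (suc n) f≗g = cong₂ _+_ (sum1-cong n (λ ℓ ℓ<n → f≗g ℓ (m<n⇒m<1+n ℓ<n))) (f≗g n (n<1+n n))

sum1-+ : ∀ (f g : ℕ → ℤ) n → sum1 (λ ℓ → f ℓ + g ℓ) n ≡ sum1 f n + sum1 g n
sum1-+ f g zero    = refl
sum1-+ f g (suc n) = begin
  sum1 (λ ℓ → f ℓ + g ℓ) n + (f (suc n) + g (suc n))
    ≡⟨ cong (_+ (f (suc n) + g (suc n))) (sum1-+ f g n) ⟩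
  sum1 f n + sum1 g n + (f (suc n) + g (suc n))
    ≡⟨ interchange (sum1 f n) (sum1 g n) (f (suc n)) (g (suc n)) ⟩
  sum1 f (suc n) + sum1 g (suc n) ∎

*-distribˡ-+₃ : ∀ c x y z → c * (x + y + z) ≡ c * x + c * y + c * z
*-distribˡ-+₃ = solve-∀

*-pos-+ : ∀ c m n → c * + (m ℕ.+ n) ≡ c * + m + c * + n
*-pos-+ c m n = trans (cong (c *_) (pos-+ m n)) (*-distribˡ-+ c (+ m) (+ n))

*-pos-+₃ : ∀ c m n k → c * + (m ℕ.+ n ℕ.+ k) ≡ c * + m + c * + n + c * + k
*-pos-+₃ c m n k = begin
  c * + (m ℕ.+ n ℕ.+ k)          ≡⟨ *-pos-+ c (m ℕ.+ n) k ⟩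
  c * + (m ℕ.+ n) + c * + k      ≡⟨ cong (_+ c * + k) (*-pos-+ c m n) ⟩
  c * + m + c * + n + c * + k    ∎

s-suc-suc-< : ∀ p q → p < q → s (suc p) (suc q) ≡ s p (suc q) ℕ.+ s (suc p) q ℕ.+ s p q
s-suc-suc-< p q p<q rewrite <⇒<ᵇ≡true p<q = refl

s-suc-suc-diag : ∀ p → s (suc p) (suc p) ≡ s p (suc p) ℕ.+ s p p
s-suc-suc-diag p rewrite <ᵇ-irrefl p | ≡ᵇ-refl p = refl

schröderTerm : ℕ → ℕ → ℕ → ℕ
schröderTerm i j ℓ = s (i ∸ ℓ) (j ∸ ℓ ∸ 1)

schröderTerm-rec : ∀ ℓ i j → ℓ < i → suc i < j →
  schröderTerm (suc i) (suc j) (suc ℓ)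
    ≡ schröderTerm i (suc j) (suc ℓ) ℕ.+ schröderTerm (suc i) j (suc ℓ) ℕ.+ schröderTerm i j (suc ℓ)
schröderTerm-rec zero    (suc i) (suc (suc j)) _         (s≤s (s≤s i<j)) = s-suc-suc-< i j i<j
schröderTerm-rec (suc ℓ) (suc i) (suc j)       (s≤s ℓ<i) (s≤s 1+i<j)    = schröderTerm-rec ℓ i j ℓ<i 1+i<j

schröderTerm-rec-superdiag : ∀ ℓ i → ℓ < i →
  schröderTerm (suc i) (suc (suc i)) (suc ℓ)
    ≡ schröderTerm i (suc (suc i)) (suc ℓ) ℕ.+ schröderTerm i (suc i) (suc ℓ)
schröderTerm-rec-superdiag zero    (suc i) _         = s-suc-suc-diag i
schröderTerm-rec-superdiag (suc ℓ) (suc i) (s≤s ℓ<i) = schröderTerm-rec-superdiag ℓ i ℓ<i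

summand : ℕ → ℕ → ℕ → ℤ
summand i j ℓ = neg1^ (ℓ ∸ 1) * + schröderTerm i j ℓ

altSum : ℕ → ℕ → ℤ
altSum i j = sum1 (summand i j) i

altSum-suc : ∀ i j → altSum (suc i) j ≡ sum1 (summand (suc i) j) i + neg1^ i
altSum-suc i j rewrite n∸n≡0 i = cong (_+_ (sum1 (summand (suc i) j) i)) (*-identityʳ (neg1^ i))

altSum-rec : ∀ i j → suc i < j → altSum (suc i) (suc j) ≡ altSum i (suc j) + altSum (suc i) j + altSum i j
altSum-rec i j 1+i<j = begin
  altSum (suc i) (suc j)
    ≡⟨ altSum-suc i (suc j) ⟩
  sum1 (summand (suc i) (suc j)) i + neg1^ i
    ≡⟨ cong (_+ neg1^ i) (sum1-cong i split) ⟩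
  sum1 (λ ℓ → f ℓ + g ℓ + h ℓ) i + neg1^ i
    ≡⟨ cong (_+ neg1^ i) (trans (sum1-+ _ h i) (cong (_+ sum1 h i) (sum1-+ f g i))) ⟩
  sum1 f i + sum1 g i + sum1 h i + neg1^ i
    ≡⟨ shift-last (sum1 f i) (sum1 g i) (sum1 h i) (neg1^ i) ⟩
  sum1 f i + (sum1 g i + neg1^ i) + sum1 h i
    ≡⟨ cong (λ t → sum1 f i + t + sum1 h i) (sym (altSum-suc i j)) ⟩
  altSum i (suc j) + altSum (suc i) j + altSum i j ∎
  where
  f g h : ℕ → ℤ
  f = summand i (suc j)
  g = summand (suc i) j
  h = summand i j
  split : ∀ ℓ → ℓ < i → summand (suc i) (suc j) (suc ℓ) ≡ f (suc ℓ) + g (suc ℓ) + h (suc ℓ)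
  split ℓ ℓ<i = trans (cong (λ n → neg1^ ℓ * + n) (schröderTerm-rec ℓ i j ℓ<i 1+i<j)) (*-pos-+₃ (neg1^ ℓ) _ _ _)
  shift-last : ∀ x y z e → x + y + z + e ≡ x + (y + e) + z
  shift-last = solve-∀

altSum-rec-superdiag : ∀ i →
  altSum (suc i) (suc (suc i)) ≡ altSum i (suc (suc i)) + altSum i (suc i) + neg1^ i
altSum-rec-superdiag i = begin
  altSum (suc i) (suc (suc i))
    ≡⟨ altSum-suc i (suc (suc i)) ⟩
  sum1 (summand (suc i) (suc (suc i))) i + neg1^ i
    ≡⟨ cong (_+ neg1^ i) (trans (sum1-cong i split) (sum1-+ f g i)) ⟩
  altSum i (suc (suc i)) + altSum i (suc i) + neg1^ i ∎
  where
  f g : ℕ → ℤ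
  f = summand i (suc (suc i))
  g = summand i (suc i)
  split : ∀ ℓ → ℓ < i → summand (suc i) (suc (suc i)) (suc ℓ) ≡ f (suc ℓ) + g (suc ℓ)
  split ℓ ℓ<i = trans (cong (λ n → neg1^ ℓ * + n) (schröderTerm-rec-superdiag ℓ i ℓ<i)) (*-pos-+ (neg1^ ℓ) _ _)

up-superdiag : ∀ i →
  up (suc (suc i)) (suc (suc (suc i)))
    ≡ up (suc i) (suc (suc (suc i))) + up (suc i) (suc (suc i)) + + 2 * neg1^ (suc i)
up-superdiag i rewrite ≡ᵇ-refl i = refl

up-off-superdiag : ∀ i j → suc (suc i) < j →
  up (suc (suc i)) (suc j) ≡ up (suc i) (suc j) + up (suc (suc i)) j + up (suc i) j
up-off-superdiag i j 2+i<j rewrite ≢⇒≡ᵇ≡false j (suc (suc i)) (>⇒≢ 2+i<j) = refl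

ClosedFormAt : ℕ → ℕ → Set
ClosedFormAt i j = up i j ≡ + 2 * altSum i j

closedForm-superdiag : ∀ i j → suc (suc i) ≡ j →
  ClosedFormAt (suc i) (suc j) → ClosedFormAt (suc i) j → ClosedFormAt (suc (suc i)) (suc j)
closedForm-superdiag i _ refl above left = begin
  up (suc (suc i)) (suc (suc (suc i)))
    ≡⟨ up-superdiag i ⟩
  up (suc i) (suc (suc (suc i))) + up (suc i) (suc (suc i)) + + 2 * neg1^ (suc i)
    ≡⟨ cong₂ (λ x y → x + y + + 2 * neg1^ (suc i)) above left ⟩
  + 2 * x + + 2 * y + + 2 * neg1^ (suc i)
    ≡⟨ sym (*-distribˡ-+₃ (+ 2) x y (neg1^ (suc i))) ⟩
  + 2 * (x + y + neg1^ (suc i))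
    ≡⟨ cong (+ 2 *_) (sym (altSum-rec-superdiag (suc i))) ⟩
  + 2 * altSum (suc (suc i)) (suc (suc (suc i))) ∎
  where
  x y : ℤ
  x = altSum (suc i) (suc (suc (suc i)))
  y = altSum (suc i) (suc (suc i))

closedForm-off-superdiag : ∀ i j → suc (suc i) < j →
  ClosedFormAt (suc i) (suc j) → ClosedFormAt (suc (suc i)) j → ClosedFormAt (suc i) j →
  ClosedFormAt (suc (suc i)) (suc j)
closedForm-off-superdiag i j 2+i<j above left diagonal = begin
  up (suc (suc i)) (suc j)
    ≡⟨ up-off-superdiag i j 2+i<j ⟩
  up (suc i) (suc j) + up (suc (suc i)) j + up (suc i) j
    ≡⟨ cong₂ _+_ (cong₂ _+_ above left) diagonal ⟩
  + 2 * x + + 2 * y + + 2 * z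
    ≡⟨ sym (*-distribˡ-+₃ (+ 2) x y z) ⟩
  + 2 * (x + y + z)
    ≡⟨ cong (+ 2 *_) (sym (altSum-rec (suc i) j 2+i<j)) ⟩
  + 2 * altSum (suc (suc i)) (suc j) ∎
  where
  x y z : ℤ
  x = altSum (suc i) (suc j)
  y = altSum (suc (suc i)) j
  z = altSum (suc i) j

closedForm : ∀ i j → suc i < j → ClosedFormAt (suc i) j
closedForm zero    j       _           = refl
closedForm (suc i) (suc j) (s≤s 1+i<j) =
  [ (λ 2+i<j → closedForm-off-superdiag i j 2+i<j above (closedForm (suc i) j 2+i<j) diagonal)
  , (λ 2+i≡j → closedForm-superdiag i j 2+i≡j above diagonal)
  ] (m≤n⇒m<n∨m≡n 1+i<j)
  where
  above : ClosedFormAt (suc i) (suc j)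
  above = closedForm i (suc j) (m<n⇒m<1+n 1+i<j)
  diagonal : ClosedFormAt (suc i) j
  diagonal = closedForm i j 1+i<j

a≡up : ∀ {i j} → i < j → a i j ≡ up i j
a≡up i<j rewrite <⇒<ᵇ≡true i<j = refl

corollary1p3 : ∀ (i j : ℕ) → 1 ≤ i → i < j →
    a i j ≡ (+ 2) * sum1 (λ ℓ → neg1^ (ℓ ∸ 1) * (+ s (i ∸ ℓ) (j ∸ ℓ ∸ 1))) i
corollary1p3 (suc i) j _ i<j = trans (a≡up i<j) (closedForm i j i<j)
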